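{- Let $S$ be a finite commutative semigroup and $g_1,\dots,g_t\in S$ (not necessarily distinct) such that $\langle\sum_{i=1}^tg_i\rangle$ is a group. Let $e=\sum_{i=1}^te(g_i)$. Then $H_e$ is a group with identity element $e$, and $\sum_{i\in I}g_i+\sum_{j\in[1,t]\setminus I}e(g_j)\in H_e$ for each subset $I\subseteq[1,t]$.
   Context: $S$ is written additively; $\langle x\rangle=\{mx:m\ge1\}$ and $e(x)$ is its unique idempotent. $(a)=\{a\}\cup(a+S)$; $a\,\mathcal H\,b$ iff $(a)=(b)$; $H_a$ is the $\mathcal H$-class of $a$. An empty sum is omitted from the expression. -}

module Defs where

open import Data.Nat using (ℕ; zero; suc)
open import Data.Fin using (Fin; zero; suc)
open import Data.Fin.Subset using (Subset; _∈_)
import Data.Fin.Subset.Properties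
open import Data.Product using (Σ; ∃; _×_; _,_)
open import Data.Sum using (_⊎_)
open import Relation.Binary.PropositionalEquality using (_≡_)
open import Relation.Nullary using (Dec; yes; no)
open import Function.Bundles using (_↔_; _⇔_)
open import Algebra.Structures using (IsCommutativeSemigroup)

Finite : Set → Set
Finite C = Σ ℕ λ n → Fin n ↔ C

module _ {C : Set} (_+_ : C → C → C) where

  -- rep k x = (k+1)x
  rep : ℕ → C → C
  rep zero    x = x
  rep (suc k) x = x + rep k x

  InCyc : C → C → Set
  InCyc x y = Σ ℕ λ k → y ≡ rep k x

  -- e is the (unique) idempotent of ⟨x⟩, i.e. e = e(x)
  IsIdemOf : C → C → Set
  IsIdemOf x e = InCyc x e × (e + e ≡ e)

  IsGroupWithId : (C → Set) → C → Set
  IsGroupWithId P u =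
    P u
    × (∀ y z → P y → P z → P (y + z))
    × (∀ y → P y → u + y ≡ y)
    × (∀ y → P y → Σ C λ z → P z × (y + z ≡ u))

  IsGroup : (C → Set) → Set
  IsGroup P = Σ C λ u → IsGroupWithId P u

  InPrincipal : C → C → Set
  InPrincipal a y = (y ≡ a) ⊎ (Σ C λ s → y ≡ a + s)

  _𝓗_ : C → C → Set
  a 𝓗 b = ∀ y → InPrincipal a y ⇔ InPrincipal b y

  InH : C → C → Set
  InH a b = a 𝓗 b

  sumF : (n : ℕ) → (Fin (suc n) → C) → C
  sumF zero    f = f zero
  sumF (suc n) f = f zero + sumF n (λ i → f (suc i))

  choose : {n : ℕ} → Subset n → (Fin n → C) → (Fin n → C) → Fin n → C
  choose I g ε i with Data.Fin.Subset.Properties._∈?_ i I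
  ... | yes _ = g i
  ... | no  _ = ε i

-- Write a ∣ b for b ∈ (a), so that a 𝓗 b means a ∣ b and b ∣ a. If e is idempotent, e acts
-- as an identity on everything it divides, and y ∣ e, say e = y + s, makes e + s an inverse
-- of y; so H_e is a group with identity e. The sum e of the idempotents e(g_i) is
-- idempotent, and a mixed sum x of g_i's and e(g_j)'s satisfies g ∣ x ∣ e for g = Σ g_i, so
-- it remains to show e ∣ x, and for this e + g = g suffices. Let u be the identity of the
-- group ⟨g⟩. Each e(g_i) = m g_i divides m g ∈ ⟨g⟩, and an idempotent ε dividing an element
-- y of a group fixes its identity: ε + u = ε + y + y⁻¹ = y + y⁻¹ = u. Hence e + u = u, and
-- e + g = e + u + g = u + g = g.
{-# OPTIONS --safe #-}
module Submission where

open import Defs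
open import Data.Nat using (ℕ; suc; zero)
open import Data.Fin using (Fin)
open import Data.Fin.Subset using (Subset)
import Data.Fin.Subset.Properties
open import Data.Product using (_×_; _,_; Σ; proj₁; proj₂)
open import Data.Sum using (inj₁; inj₂)
open import Relation.Nullary using (yes; no)
open import Function.Bundles using (mk⇔; Equivalence)
open import Relation.Binary.PropositionalEquality
open import Algebra.Structures using (IsCommutativeSemigroup)
open import Algebra.Bundles using (CommutativeSemigroup)
import Algebra.Properties.CommutativeSemigroup as CommutativeSemigroupProperties

module CommutativeSemigroupTheory {C : Set} (_+_ : C → C → C)
                                  (isCS : IsCommutativeSemigroup _≡_ _+_) where
  open IsCommutativeSemigroup isCS using (assoc; comm)

  commutativeSemigroup : CommutativeSemigroup _ _
  commutativeSemigroup = record { isCommutativeSemigroup = isCS }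

  open CommutativeSemigroupProperties commutativeSemigroup using (interchange; xy∙z≈xz∙y)
  open ≡-Reasoning

  infix 4 _∣_
  _∣_ : C → C → Set
  _∣_ = InPrincipal _+_

  ∣-refl : ∀ {a} → a ∣ a
  ∣-refl = inj₁ refl

  ∣-trans : ∀ {a b c} → a ∣ b → b ∣ c → a ∣ c
  ∣-trans     (inj₁ refl)       b∣c               = b∣c
  ∣-trans     (inj₂ (s , refl)) (inj₁ refl)       = inj₂ (s , refl)
  ∣-trans {a} (inj₂ (s , refl)) (inj₂ (t , refl)) = inj₂ (s + t , assoc a s t)

  ∣-+ˡ : ∀ a b → b ∣ a + b
  ∣-+ˡ a b = inj₂ (a , comm a b)

  +-mono-∣ : ∀ {a b c d} → a ∣ b → c ∣ d → a + c ∣ b + d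
  +-mono-∣             (inj₁ refl)       (inj₁ refl)       = inj₁ refl
  +-mono-∣ {a} {c = c} (inj₁ refl)       (inj₂ (t , refl)) = inj₂ (t , sym (assoc a c t))
  +-mono-∣ {a} {c = c} (inj₂ (s , refl)) (inj₁ refl)       = inj₂ (s , xy∙z≈xz∙y a s c)
  +-mono-∣ {a} {c = c} (inj₂ (s , refl)) (inj₂ (t , refl)) = inj₂ (s + t , interchange a s c t)

  ∣×∣⇒𝓗 : ∀ {a b} → a ∣ b × b ∣ a → _𝓗_ _+_ a b
  ∣×∣⇒𝓗 (a∣b , b∣a) y = mk⇔ (∣-trans b∣a) (∣-trans a∣b)

  𝓗⇒∣×∣ : ∀ {a b} → _𝓗_ _+_ a b → a ∣ b × b ∣ a
  𝓗⇒∣×∣ {a} {b} a𝓗b = Equivalence.from (a𝓗b b) ∣-refl , Equivalence.to (a𝓗b a) ∣-refl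

  identityˡ⇒∣ : ∀ {a b} → a + b ≡ b → a ∣ b
  identityˡ⇒∣ {b = b} a+b≡b = inj₂ (b , sym a+b≡b)

  identityˡ-∣ : ∀ {a b x} → a + b ≡ b → b ∣ x → a + x ≡ x
  identityˡ-∣ a+b≡b (inj₁ refl) = a+b≡b
  identityˡ-∣ {a} {b} a+b≡b (inj₂ (s , refl)) = begin
    a + (b + s)  ≡⟨ assoc a b s ⟨
    (a + b) + s  ≡⟨ cong (_+ s) a+b≡b ⟩
    b + s        ∎

  idempotent⇒H-isGroup : ∀ {e} → e + e ≡ e → IsGroupWithId _+_ (InH _+_ e) e
  idempotent⇒H-isGroup {e} e+e≡e = ∣×∣⇒𝓗 (∣-refl , ∣-refl) , closed , identity , inverse
    where
    closed : ∀ y z → InH _+_ e y → InH _+_ e z → InH _+_ e (y + z)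
    closed y z e𝓗y e𝓗z with 𝓗⇒∣×∣ e𝓗y | 𝓗⇒∣×∣ e𝓗z
    ... | e∣y , y∣e | e∣z , z∣e =
      ∣×∣⇒𝓗 ( subst (_∣ y + z) e+e≡e (+-mono-∣ e∣y e∣z)
            , subst (y + z ∣_) e+e≡e (+-mono-∣ y∣e z∣e))

    identity : ∀ y → InH _+_ e y → e + y ≡ y
    identity y e𝓗y = identityˡ-∣ e+e≡e (proj₁ (𝓗⇒∣×∣ e𝓗y))

    inverse : ∀ y → InH _+_ e y → Σ C λ z → InH _+_ e z × (y + z ≡ e)
    inverse y e𝓗y with 𝓗⇒∣×∣ e𝓗y
    ... | _ , inj₁ e≡y = e , ∣×∣⇒𝓗 (∣-refl , ∣-refl) , trans (cong (_+ e) (sym e≡y)) e+e≡e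
    ... | _ , inj₂ (s , e≡y+s) =
      e + s , ∣×∣⇒𝓗 (inj₂ (s , refl) , inj₂ (y , sym [e+s]+y≡e)) , trans (comm y (e + s)) [e+s]+y≡e
      where
      [e+s]+y≡e : (e + s) + y ≡ e
      [e+s]+y≡e = begin
        (e + s) + y  ≡⟨ xy∙z≈xz∙y e s y ⟩
        (e + y) + s  ≡⟨ assoc e y s ⟩
        e + (y + s)  ≡⟨ cong (e +_) e≡y+s ⟨
        e + e        ≡⟨ e+e≡e ⟩
        e            ∎

  rep-+ : ∀ k x y → rep _+_ k (x + y) ≡ rep _+_ k x + rep _+_ k y
  rep-+ zero    x y = refl
  rep-+ (suc k) x y = begin
    (x + y) + rep _+_ k (x + y)                ≡⟨ cong ((x + y) +_) (rep-+ k x y) ⟩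
    (x + y) + (rep _+_ k x + rep _+_ k y)      ≡⟨ interchange x y _ _ ⟩
    (x + rep _+_ k x) + (y + rep _+_ k y)      ∎

  rep-monoʳ-∣ : ∀ k {x y} → x ∣ y → rep _+_ k x ∣ rep _+_ k y
  rep-monoʳ-∣ k     (inj₁ refl)       = ∣-refl
  rep-monoʳ-∣ k {x} (inj₂ (s , refl)) = inj₂ (rep _+_ k s , rep-+ k x s)

  isIdemOf⇒∣ : ∀ {g ε} → IsIdemOf _+_ g ε → g ∣ ε
  isIdemOf⇒∣     ((zero  , ε≡g) , _)   = inj₁ ε≡g
  isIdemOf⇒∣ {g} ((suc k , ε≡rep) , _) = inj₂ (rep _+_ k g , ε≡rep)

  summand-∣-sumF : ∀ n (f : Fin (suc n) → C) i → f i ∣ sumF _+_ n f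
  summand-∣-sumF zero    f Fin.zero    = ∣-refl
  summand-∣-sumF (suc n) f Fin.zero    = inj₂ (sumF _+_ n (λ i → f (Fin.suc i)) , refl)
  summand-∣-sumF (suc n) f (Fin.suc i) =
    ∣-trans (summand-∣-sumF n (λ i → f (Fin.suc i)) i) (∣-+ˡ (f Fin.zero) _)

  sumF-mono-∣ : ∀ n {f h : Fin (suc n) → C} → (∀ i → f i ∣ h i) → sumF _+_ n f ∣ sumF _+_ n h
  sumF-mono-∣ zero    f∣h = f∣h Fin.zero
  sumF-mono-∣ (suc n) f∣h = +-mono-∣ (f∣h Fin.zero) (sumF-mono-∣ n (λ i → f∣h (Fin.suc i)))

  sumF-idempotent : ∀ n (f : Fin (suc n) → C) → (∀ i → f i + f i ≡ f i) →
                    sumF _+_ n f + sumF _+_ n f ≡ sumF _+_ n f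
  sumF-idempotent zero    f idem = idem Fin.zero
  sumF-idempotent (suc n) f idem =
    trans (interchange _ _ _ _)
          (cong₂ _+_ (idem Fin.zero) (sumF-idempotent n _ (λ i → idem (Fin.suc i))))

  sumF-identityˡ : ∀ n (f : Fin (suc n) → C) {u} → (∀ i → f i + u ≡ u) → sumF _+_ n f + u ≡ u
  sumF-identityˡ zero    f fix = fix Fin.zero
  sumF-identityˡ (suc n) f {u} fix = begin
    (f Fin.zero + sumF _+_ n _) + u  ≡⟨ assoc _ _ u ⟩
    f Fin.zero + (sumF _+_ n _ + u)  ≡⟨ cong (f Fin.zero +_) (sumF-identityˡ n _ (λ i → fix (Fin.suc i))) ⟩
    f Fin.zero + u                   ≡⟨ fix Fin.zero ⟩
    u                                ∎

  choose-between : ∀ {n} (I : Subset n) {g ε : Fin n → C} → (∀ i → g i ∣ ε i) →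
                   ∀ i → g i ∣ choose _+_ I g ε i × choose _+_ I g ε i ∣ ε i
  choose-between I g∣ε i with Data.Fin.Subset.Properties._∈?_ i I
  ... | yes _ = ∣-refl , g∣ε i
  ... | no  _ = g∣ε i , ∣-refl

  idempotent-∣-member⇒identityˡ : ∀ {P u y ε} → IsGroupWithId _+_ P u → P y →
                                   ε + ε ≡ ε → ε ∣ y → ε + u ≡ u
  idempotent-∣-member⇒identityˡ {u = u} {y} {ε} (_ , _ , _ , inverse) Py ε+ε≡ε ε∣y
    with inverse y Py
  ... | z , _ , y+z≡u = begin
    ε + u        ≡⟨ cong (ε +_) y+z≡u ⟨
    ε + (y + z)  ≡⟨ assoc ε y z ⟨
    (ε + y) + z  ≡⟨ cong (_+ z) (identityˡ-∣ ε+ε≡ε ε∣y) ⟩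
    y + z        ≡⟨ y+z≡u ⟩
    u            ∎

  isIdemOf-∣⇒identityˡ : ∀ {g ε x u} → IsGroupWithId _+_ (InCyc _+_ x) u →
                          g ∣ x → IsIdemOf _+_ g ε → ε + u ≡ u
  isIdemOf-∣⇒identityˡ {x = x} ⟨x⟩-group g∣x ((k , ε≡kg) , ε+ε≡ε) =
    idempotent-∣-member⇒identityˡ ⟨x⟩-group (k , refl) ε+ε≡ε
      (subst (_∣ rep _+_ k x) (sym ε≡kg) (rep-monoʳ-∣ k g∣x))

-- Finiteness only guarantees that the idempotents e(g_i) exist; here they are given as ε.
lemma3p17 : {C : Set} (_+_ : C → C → C)
    → IsCommutativeSemigroup _≡_ _+_
    → Finite C
    → (n : ℕ) (g : Fin (suc n) → C) (ε : Fin (suc n) → C)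
    → (∀ i → IsIdemOf _+_ (g i) (ε i))
    → IsGroup _+_ (InCyc _+_ (sumF _+_ n g))
    → IsGroupWithId _+_ (InH _+_ (sumF _+_ n ε)) (sumF _+_ n ε)
    × ((I : Subset (suc n)) → InH _+_ (sumF _+_ n ε) (sumF _+_ n (choose _+_ I g ε)))
lemma3p17 _+_ isCS _ n g ε isIdem (u , ⟨Σg⟩-group@(_ , _ , identity , _)) =
  idempotent⇒H-isGroup Σε+Σε≡Σε , Σε-𝓗-mixed
  where
  open CommutativeSemigroupTheory _+_ isCS

  Σε+Σε≡Σε : sumF _+_ n ε + sumF _+_ n ε ≡ sumF _+_ n ε
  Σε+Σε≡Σε = sumF-idempotent n ε (λ i → proj₂ (isIdem i))

  Σε+u≡u : sumF _+_ n ε + u ≡ u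
  Σε+u≡u = sumF-identityˡ n ε
    (λ i → isIdemOf-∣⇒identityˡ ⟨Σg⟩-group (summand-∣-sumF n g i) (isIdem i))

  u+Σg≡Σg : u + sumF _+_ n g ≡ sumF _+_ n g
  u+Σg≡Σg = identity (sumF _+_ n g) (zero , refl)

  Σε-𝓗-mixed : (I : Subset (suc n)) → InH _+_ (sumF _+_ n ε) (sumF _+_ n (choose _+_ I g ε))
  Σε-𝓗-mixed I = ∣×∣⇒𝓗 (identityˡ⇒∣ Σε+x≡x , sumF-mono-∣ n (λ i → proj₂ (between i)))
    where
    between : ∀ i → g i ∣ choose _+_ I g ε i × choose _+_ I g ε i ∣ ε i
    between = choose-between I (λ i → isIdemOf⇒∣ (isIdem i))

    Σε+x≡x : sumF _+_ n ε + sumF _+_ n (choose _+_ I g ε) ≡ sumF _+_ n (choose _+_ I g ε)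
    Σε+x≡x = identityˡ-∣ (identityˡ-∣ Σε+u≡u (identityˡ⇒∣ u+Σg≡Σg))
                         (sumF-mono-∣ n (λ i → proj₁ (between i)))
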